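{- For every integer $n\geq 0$, the number of Fishburn permutations of length $n$ that simultaneously avoid the classical patterns $321$, $2143$ and $4123$ equals $\binom{n}{2}+1$.
   Context: A permutation of length $n$ is a rearrangement $\pi=\pi_1\cdots\pi_n$ of $[n]$ (for $n=0$ there is exactly one, the empty permutation). A permutation $\pi$ contains a classical pattern $p\in S_k$ if some subsequence of $\pi$ of length $k$ is order-isomorphic to $p$; otherwise it avoids $p$. A Fishburn permutation is a permutation $\pi$ for which there are no indices $i<j$ with $\pi_j<\pi_i<\pi_{i+1}$ and $\pi_i=\pi_j+1$. -}

module Defs where

open import Data.Nat using (ℕ; zero; suc; _<ᵇ_; _≡ᵇ_)
open import Data.Bool using (Bool; true; false; _∧_; _∨_; not; if_then_else_)
open import Data.Fin using (Fin; toℕ)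
open import Data.Vec using (Vec; []; _∷_; lookup; toList)
open import Data.List using (List; []; _∷_; map; concatMap; filter; length; tabulate; _++_; zipWith)
open import Data.Bool.ListAction using (all; any; and)
open import Relation.Nullary.Decidable using (does)
open import Data.Bool.Properties using (T?)

_⇒ᵇ_ : Bool → Bool → Bool
a ⇒ᵇ b = not a ∨ b

_⇔ᵇ_ : Bool → Bool → Bool
a ⇔ᵇ b = (a ⇒ᵇ b) ∧ (b ⇒ᵇ a)

-- A word of length n over [n] (values 0,…,n-1, i.e. [n] shifted by one,
-- which does not affect order-isomorphism or the Fishburn condition).
Word : ℕ → Set
Word n = Vec (Fin n) n

allWords : (n m : ℕ) → List (Vec (Fin n) m)
allWords n zero    = [] ∷ []
allWords n (suc m) = concatMap (λ x → map (x ∷_) (allWords n m)) (tabulate (λ (i : Fin n) → i))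

val : ∀ {n} → Word n → Fin n → ℕ
val w i = toℕ (lookup w i)

isPerm : ∀ {n} → Word n → Bool
isPerm {n} w = all (λ i → all (λ j → (toℕ i <ᵇ toℕ j) ⇒ᵇ not (val w i ≡ᵇ val w j)) idx) idx
  where idx = tabulate (λ (i : Fin n) → i)

perms : (n : ℕ) → List (Word n)
perms n = filter (λ w → T? (isPerm w)) (allWords n n)

sublists : {A : Set} → List A → List (List A)
sublists []       = [] ∷ []
sublists (x ∷ xs) = map (x ∷_) (sublists xs) ++ sublists xs

orderIso : List ℕ → List ℕ → Bool
orderIso []       []       = true
orderIso []       (_ ∷ _)  = false
orderIso (_ ∷ _)  []       = false
orderIso (x ∷ xs) (y ∷ ys) =
  and (zipWith (λ x′ y′ → ((x <ᵇ x′) ⇔ᵇ (y <ᵇ y′)) ∧ ((x′ <ᵇ x) ⇔ᵇ (y′ <ᵇ y))) xs ys)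
  ∧ orderIso xs ys

contains : ∀ {n} → Word n → List ℕ → Bool
contains w p = any (λ s → orderIso s p) (sublists (map toℕ (toList w)))

avoids : ∀ {n} → Word n → List ℕ → Bool
avoids w p = not (contains w p)

isFishburn : ∀ {n} → Word n → Bool
isFishburn {n} w =
  not (any (λ i → any (λ i′ → any (λ j →
          (toℕ i′ ≡ᵇ suc (toℕ i)) ∧ (toℕ i <ᵇ toℕ j)
        ∧ (val w j <ᵇ val w i) ∧ (val w i <ᵇ val w i′)
        ∧ (val w i ≡ᵇ suc (val w j))) idx) idx) idx)
  where idx = tabulate (λ (i : Fin n) → i)

p321 p2143 p4123 : List ℕ
p321  = 3 ∷ 2 ∷ 1 ∷ []
p2143 = 2 ∷ 1 ∷ 4 ∷ 3 ∷ []
p4123 = 4 ∷ 1 ∷ 2 ∷ 3 ∷ []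

countF : ℕ → ℕ
countF n = length (filter (λ w → T? (isFishburn w ∧ avoids w p321 ∧ avoids w p2143 ∧ avoids w p4123)) (perms n))

-- A Fishburn permutation avoiding 321, 2143 and 4123 (values 0-based) either starts with 0,
-- and is then 1 ⊕ σ for such a σ one shorter, or it starts with 1 or 2: after a first entry
-- ≥ 3 the values 0, 1, 2 would have to follow in increasing order (else 321), giving 4123.
-- After a first entry 1 or 2 the second entry is 0 (the Fishburn condition rules out an
-- ascent, 321 a smaller descent), and avoiding 2143 makes the later entries exceeding the first
-- one increasing.  Hence the permutation is 1 0 2 3 … or 2 0 3 4 … q 1 q+1 … with the value 1
-- at some position q ≥ 2.  So there are n new permutations of length n + 1, and the count
-- c satisfies c (n + 1) = c n + n, c 0 = 1, i.e. c n = C(n,2) + 1.  The brute-force count of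
-- the statement is matched against this explicit duplicate-free enumeration.

module Submission where

open import Defs
open import Data.Bool using (Bool; true; false; T; not; _∧_; if_then_else_)
open import Data.Bool.ListAction using (and; all; any)
open import Data.Bool.Properties using (T?; T-∧; T-≡; T-not-≡)
open import Data.Empty using (⊥-elim)
open import Data.Fin as Fin using (Fin; toℕ; fromℕ<; punchOut)
import Data.Fin.Properties as Finₚ
open import Data.List using (List; []; _∷_; map; length; filter; drop; tabulate; allFin; zipWith; _++_)
open import Data.List.Properties using (length-map; length-++; length-tabulate)
open import Data.List.Membership.Propositional using (_∈_; find; lose)
open import Data.List.Membership.Propositional.Properties
  using (∈-map⁺; ∈-map⁻; ∈-++⁺ˡ; ∈-++⁺ʳ; ∈-++⁻; ∈-concat⁺′; ∈-tabulate⁺; ∈-allFin; ∈-filter⁺; ∈-filter⁻)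
open import Data.List.Membership.Propositional.Properties.WithK using (unique∧set⇒bag)
open import Data.List.Relation.Binary.BagAndSetEquality using (∼bag⇒↭)
open import Data.List.Relation.Binary.Disjoint.Propositional using (Disjoint)
open import Data.List.Relation.Binary.Permutation.Propositional.Properties using (↭-length)
open import Data.List.Relation.Binary.Pointwise using (Pointwise; []; _∷_)
open import Data.List.Relation.Unary.All as All using (All; []; _∷_)
import Data.List.Relation.Unary.All.Properties as Allₚ
open import Data.List.Relation.Unary.AllPairs using (AllPairs; []; _∷_)
import Data.List.Relation.Unary.AllPairs.Properties as AllPairsₚ
open import Data.List.Relation.Unary.Any using (here; there)
import Data.List.Relation.Unary.Any.Properties as Anyₚ
open import Data.List.Relation.Unary.Unique.Propositional using (Unique)
import Data.List.Relation.Unary.Unique.Propositional.Properties as Uniqueₚ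
open import Data.Nat using (ℕ; zero; suc; _+_; _<_; _≤_; _≮_; z≤n; s≤s; z<s; _<ᵇ_; _≡ᵇ_; _<?_)
open import Data.Nat.Combinatorics using (_C_; nCk+nC[k+1]≡[n+1]C[k+1]; nC1≡n)
open import Data.Nat.Properties
open import Data.Product using (∃; ∃-syntax; _×_; _,_; proj₁; proj₂)
open import Data.Sum using (_⊎_; inj₁; inj₂)
open import Data.Unit using (tt)
open import Data.Vec as Vec using (Vec; []; _∷_; lookup; toList)
import Data.Vec.Properties as Vecₚ
open import Function using (_∘_)
open import Function.Bundles using (Equivalence; _⇔_; mk⇔)
import Function.Properties.Equivalence as ⇔
open import Relation.Binary.Definitions using (Tri; tri<; tri≈; tri>)
open import Relation.Binary.PropositionalEquality
open import Relation.Nullary using (¬_; yes; no; contradiction)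

open Equivalence using (to; from)

T-not⁺ : ∀ {b} → ¬ T b → T (not b)
T-not⁺ {false} _  = tt
T-not⁺ {true}  ¬t = ¬t tt

T-not⁻ : ∀ {b} → T (not b) → ¬ T b
T-not⁻ {false} _ ()

T-⇒ᵇ : ∀ {a b} → T (a ⇒ᵇ b) ⇔ (T a → T b)
T-⇒ᵇ {false} = mk⇔ (λ _ ()) (λ _ → tt)
T-⇒ᵇ {true}  = mk⇔ (λ t _ → t) (λ f → f tt)

T-⇔ᵇ : ∀ {a b} → T (a ⇔ᵇ b) ⇔ (T a ⇔ T b)
T-⇔ᵇ = mk⇔
  (λ t → let a⇒b , b⇒a = to T-∧ t in mk⇔ (to T-⇒ᵇ a⇒b) (to T-⇒ᵇ b⇒a))
  (λ e → from T-∧ (from T-⇒ᵇ (to e) , from T-⇒ᵇ (from e)))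

T-<ᵇ : ∀ {m n} → T (m <ᵇ n) ⇔ m < n
T-<ᵇ = mk⇔ (<ᵇ⇒< _ _) <⇒<ᵇ

<ᵇ-true : ∀ {m n} → m < n → (m <ᵇ n) ≡ true
<ᵇ-true m<n = to T-≡ (<⇒<ᵇ m<n)

<ᵇ-false : ∀ {m n} → n ≤ m → (m <ᵇ n) ≡ false
<ᵇ-false n≤m = to T-not-≡ (T-not⁺ (λ t → <⇒≱ (<ᵇ⇒< _ _ t) n≤m))

≡ᵇ-true : ∀ {m n} → m ≡ n → (m ≡ᵇ n) ≡ true
≡ᵇ-true m≡n = to T-≡ (≡⇒≡ᵇ _ _ m≡n)

≡ᵇ-false : ∀ {m n} → m ≢ n → (m ≡ᵇ n) ≡ false
≡ᵇ-false m≢n = to T-not-≡ (T-not⁺ (λ t → m≢n (≡ᵇ⇒≡ _ _ t)))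

infixr 6 _∧ᵀ_

_∧ᵀ_ : ∀ {a b} → T a → T b → T (a ∧ b)
ta ∧ᵀ tb = from T-∧ (ta , tb)

T-allFin : ∀ {n} {f : Fin n → Bool} → T (all f (tabulate (λ i → i))) ⇔ (∀ i → T (f i))
T-allFin {f = f} = mk⇔ (λ t → Allₚ.tabulate⁻ (Allₚ.all⁺ f _ t)) (λ h → Allₚ.all⁻ f (Allₚ.tabulate⁺ h))

T-anyFin : ∀ {n} {f : Fin n → Bool} → T (any f (tabulate (λ i → i))) ⇔ ∃ λ i → T (f i)
T-anyFin {f = f} = mk⇔ (λ t → Anyₚ.tabulate⁻ (Anyₚ.any⁻ f _ t)) (λ (i , t) → Anyₚ.any⁺ f (Anyₚ.tabulate⁺ i t))

sameOrder : ℕ → ℕ → ℕ → ℕ → Bool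
sameOrder x y x′ y′ = ((x <ᵇ x′) ⇔ᵇ (y <ᵇ y′)) ∧ ((x′ <ᵇ x) ⇔ᵇ (y′ <ᵇ y))

T-sameOrder : ∀ {x y x′ y′} → T (sameOrder x y x′ y′) ⇔ ((x < x′ ⇔ y < y′) × (x′ < x ⇔ y′ < y))
T-sameOrder = mk⇔
  (λ t → let l , r = to T-∧ t in reflect (to T-⇔ᵇ l) , reflect (to T-⇔ᵇ r))
  (λ (l , r) → from T-⇔ᵇ (reify l) ∧ᵀ from T-⇔ᵇ (reify r))
  where
  reflect : ∀ {a b c d} → (T (a <ᵇ b) ⇔ T (c <ᵇ d)) → (a < b ⇔ c < d)
  reflect e = ⇔.trans (⇔.sym T-<ᵇ) (⇔.trans e T-<ᵇ)
  reify : ∀ {a b c d} → (a < b ⇔ c < d) → (T (a <ᵇ b) ⇔ T (c <ᵇ d))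
  reify e = ⇔.trans T-<ᵇ (⇔.trans e (⇔.sym T-<ᵇ))

sameOrder-desc : ∀ {x x′} y y′ → T (y′ <ᵇ y) → T (sameOrder x y x′ y′) ⇔ x′ < x
sameOrder-desc {x} {x′} y y′ t = mk⇔
  (λ s → from (proj₂ (to T-sameOrder s)) y′<y)
  (λ x′<x → from T-sameOrder
    ( mk⇔ (λ x<x′ → ⊥-elim (<-asym x<x′ x′<x)) (λ y<y′ → ⊥-elim (<-asym y<y′ y′<y))
    , mk⇔ (λ _ → y′<y) (λ _ → x′<x)))
  where y′<y = <ᵇ⇒< y′ y t

sameOrder-asc : ∀ {x x′} y y′ → T (y <ᵇ y′) → T (sameOrder x y x′ y′) ⇔ x < x′
sameOrder-asc {x} {x′} y y′ t = mk⇔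
  (λ s → from (proj₁ (to T-sameOrder s)) y<y′)
  (λ x<x′ → from T-sameOrder
    ( mk⇔ (λ _ → y<y′) (λ _ → x<x′)
    , mk⇔ (λ x′<x → ⊥-elim (<-asym x<x′ x′<x)) (λ y′<y → ⊥-elim (<-asym y<y′ y′<y))))
  where y<y′ = <ᵇ⇒< y y′ t

orderIso-length : ∀ s p → T (orderIso s p) → length s ≡ length p
orderIso-length []      []      _ = refl
orderIso-length (x ∷ s) (y ∷ p) t = cong suc (orderIso-length s p (proj₂ (to (T-∧ {and (zipWith (sameOrder x y) s p)}) t)))

T-and-zipWith : ∀ {f : ℕ → ℕ → Bool} xs ys → length xs ≡ length ys →
                T (and (zipWith f xs ys)) ⇔ Pointwise (λ x y → T (f x y)) xs ys
T-and-zipWith []       []       _  = mk⇔ (λ _ → []) (λ _ → tt)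
T-and-zipWith {f} (x ∷ xs) (y ∷ ys) eq = mk⇔
  (λ t → let fxy , rest = to (T-∧ {f x y}) t in fxy ∷ to tails rest)
  (λ { (fxy ∷ rest) → from (T-∧ {f x y}) (fxy , from tails rest) })
  where tails = T-and-zipWith xs ys (suc-injective eq)

orderIso-∷ : ∀ x y xs ys → T (orderIso (x ∷ xs) (y ∷ ys)) ⇔
             (Pointwise (λ x′ y′ → T (sameOrder x y x′ y′)) xs ys × T (orderIso xs ys))
orderIso-∷ x y xs ys = mk⇔
  (λ t → let heads , rest = to (T-∧ {and (zipWith (sameOrder x y) xs ys)}) t
         in to (T-and-zipWith xs ys (orderIso-length xs ys rest)) heads , rest)
  (λ (heads , rest) → from (T-∧ {and (zipWith (sameOrder x y) xs ys)})
      (from (T-and-zipWith xs ys (orderIso-length xs ys rest)) heads , rest))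

orderIso-321 : ∀ {a b c} → T (orderIso (a ∷ b ∷ c ∷ []) p321) ⇔ (c < b × b < a)
orderIso-321 {a} {b} {c} = mk⇔ iso⇒order order⇒iso
  where
  iso⇒order : T (orderIso (a ∷ b ∷ c ∷ []) p321) → c < b × b < a
  iso⇒order t with to (orderIso-∷ a 3 (b ∷ c ∷ []) (2 ∷ 1 ∷ [])) t
  ... | ab ∷ _ ∷ [] , t′ with to (orderIso-∷ b 2 (c ∷ []) (1 ∷ [])) t′
  ...   | bc ∷ [] , _ = to (sameOrder-desc 2 1 _) bc , to (sameOrder-desc 3 2 _) ab
  order⇒iso : c < b × b < a → T (orderIso (a ∷ b ∷ c ∷ []) p321)
  order⇒iso (c<b , b<a) = from (orderIso-∷ a 3 (b ∷ c ∷ []) (2 ∷ 1 ∷ []))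
    ( from (sameOrder-desc 3 2 _) b<a ∷ from (sameOrder-desc 3 1 _) (<-trans c<b b<a) ∷ []
    , from (orderIso-∷ b 2 (c ∷ []) (1 ∷ [])) (from (sameOrder-desc 2 1 _) c<b ∷ [] , tt))

orderIso-2143 : ∀ {a b c d} → T (orderIso (a ∷ b ∷ c ∷ d ∷ []) p2143) ⇔ (b < a × a < d × d < c)
orderIso-2143 {a} {b} {c} {d} = mk⇔ iso⇒order order⇒iso
  where
  iso⇒order : T (orderIso (a ∷ b ∷ c ∷ d ∷ []) p2143) → b < a × a < d × d < c
  iso⇒order t with to (orderIso-∷ a 2 (b ∷ c ∷ d ∷ []) (1 ∷ 4 ∷ 3 ∷ [])) t
  ... | ab ∷ _ ∷ ad ∷ [] , t′ with to (orderIso-∷ b 1 (c ∷ d ∷ []) (4 ∷ 3 ∷ [])) t′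
  ...   | _ , t″ with to (orderIso-∷ c 4 (d ∷ []) (3 ∷ [])) t″
  ...     | cd ∷ [] , _ = to (sameOrder-desc 2 1 _) ab , to (sameOrder-asc 2 3 _) ad , to (sameOrder-desc 4 3 _) cd
  order⇒iso : b < a × a < d × d < c → T (orderIso (a ∷ b ∷ c ∷ d ∷ []) p2143)
  order⇒iso (b<a , a<d , d<c) = from (orderIso-∷ a 2 (b ∷ c ∷ d ∷ []) (1 ∷ 4 ∷ 3 ∷ []))
    ( from (sameOrder-desc 2 1 _) b<a ∷ from (sameOrder-asc 2 4 _) (<-trans a<d d<c)
        ∷ from (sameOrder-asc 2 3 _) a<d ∷ []
    , from (orderIso-∷ b 1 (c ∷ d ∷ []) (4 ∷ 3 ∷ []))
      ( from (sameOrder-asc 1 4 _) (<-trans b<a (<-trans a<d d<c))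
          ∷ from (sameOrder-asc 1 3 _) (<-trans b<a a<d) ∷ []
      , from (orderIso-∷ c 4 (d ∷ []) (3 ∷ [])) (from (sameOrder-desc 4 3 _) d<c ∷ [] , tt)))

orderIso-4123 : ∀ {a b c d} → T (orderIso (a ∷ b ∷ c ∷ d ∷ []) p4123) ⇔ (b < c × c < d × d < a)
orderIso-4123 {a} {b} {c} {d} = mk⇔ iso⇒order order⇒iso
  where
  iso⇒order : T (orderIso (a ∷ b ∷ c ∷ d ∷ []) p4123) → b < c × c < d × d < a
  iso⇒order t with to (orderIso-∷ a 4 (b ∷ c ∷ d ∷ []) (1 ∷ 2 ∷ 3 ∷ [])) t
  ... | _ ∷ _ ∷ ad ∷ [] , t′ with to (orderIso-∷ b 1 (c ∷ d ∷ []) (2 ∷ 3 ∷ [])) t′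
  ...   | bc ∷ _ ∷ [] , t″ with to (orderIso-∷ c 2 (d ∷ []) (3 ∷ [])) t″
  ...     | cd ∷ [] , _ = to (sameOrder-asc 1 2 _) bc , to (sameOrder-asc 2 3 _) cd , to (sameOrder-desc 4 3 _) ad
  order⇒iso : b < c × c < d × d < a → T (orderIso (a ∷ b ∷ c ∷ d ∷ []) p4123)
  order⇒iso (b<c , c<d , d<a) = from (orderIso-∷ a 4 (b ∷ c ∷ d ∷ []) (1 ∷ 2 ∷ 3 ∷ []))
    ( from (sameOrder-desc 4 1 _) (<-trans b<c (<-trans c<d d<a))
        ∷ from (sameOrder-desc 4 2 _) (<-trans c<d d<a) ∷ from (sameOrder-desc 4 3 _) d<a ∷ []
    , from (orderIso-∷ b 1 (c ∷ d ∷ []) (2 ∷ 3 ∷ []))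
      ( from (sameOrder-asc 1 2 _) b<c ∷ from (sameOrder-asc 1 3 _) (<-trans b<c c<d) ∷ []
      , from (orderIso-∷ c 2 (d ∷ []) (3 ∷ [])) (from (sameOrder-asc 2 3 _) c<d ∷ [] , tt)))

-- 0 is a junk value beyond the end of the list.
nth : List ℕ → ℕ → ℕ
nth []       _       = 0
nth (x ∷ xs) zero    = x
nth (x ∷ xs) (suc p) = nth xs p

[]∈sublists : ∀ {A : Set} (xs : List A) → [] ∈ sublists xs
[]∈sublists []       = here refl
[]∈sublists (x ∷ xs) = ∈-++⁺ʳ (map (x ∷_) (sublists xs)) ([]∈sublists xs)

∷∈sublists-drop : ∀ xs {k p s} → k ≤ p → p < length xs → s ∈ sublists (drop (suc p) xs) →
                  nth xs p ∷ s ∈ sublists (drop k xs)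
∷∈sublists-drop (x ∷ xs) {zero}  {zero}  _         _          s∈ = ∈-++⁺ˡ (∈-map⁺ (x ∷_) s∈)
∷∈sublists-drop (x ∷ xs) {zero}  {suc p} _         (s≤s p<n) s∈ =
  ∈-++⁺ʳ (map (x ∷_) (sublists xs)) (∷∈sublists-drop xs z≤n p<n s∈)
∷∈sublists-drop (x ∷ xs) {suc k} {suc p} (s≤s k≤p) (s≤s p<n) s∈ = ∷∈sublists-drop xs k≤p p<n s∈

∷∈sublists-drop⁻ : ∀ xs {k a s} → a ∷ s ∈ sublists (drop k xs) →
  ∃[ p ] k ≤ p × p < length xs × nth xs p ≡ a × s ∈ sublists (drop (suc p) xs)
∷∈sublists-drop⁻ [] {zero}  (here ())
∷∈sublists-drop⁻ [] {zero}  (there ())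
∷∈sublists-drop⁻ [] {suc k} (here ())
∷∈sublists-drop⁻ [] {suc k} (there ())
∷∈sublists-drop⁻ (x ∷ xs) {zero} a∷s∈ with ∈-++⁻ (map (x ∷_) (sublists xs)) a∷s∈
... | inj₁ a∷s∈′ with ∈-map⁻ (x ∷_) a∷s∈′
...   | _ , s∈ , refl = zero , z≤n , z<s , refl , s∈
∷∈sublists-drop⁻ (x ∷ xs) {zero} a∷s∈ | inj₂ a∷s∈′ with ∷∈sublists-drop⁻ xs {0} a∷s∈′
... | p , _ , p<n , nth≡a , s∈ = suc p , z≤n , s≤s p<n , nth≡a , s∈
∷∈sublists-drop⁻ (x ∷ xs) {suc k} a∷s∈ with ∷∈sublists-drop⁻ xs a∷s∈
... | p , k≤p , p<n , nth≡a , s∈ = suc p , s≤s k≤p , s≤s p<n , nth≡a , s∈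

∈-sublists⁺ : ∀ xs {k ixs} → AllPairs _<_ ixs → All (k ≤_) ixs → All (_< length xs) ixs →
              map (nth xs) ixs ∈ sublists (drop k xs)
∈-sublists⁺ xs {k} []                [] []            = []∈sublists (drop k xs)
∈-sublists⁺ xs (i<ixs ∷ increasing) (k≤i ∷ _) (i<n ∷ ixs<n) =
  ∷∈sublists-drop xs k≤i i<n (∈-sublists⁺ xs increasing i<ixs ixs<n)

∈-sublists⁻ : ∀ xs {k s} → s ∈ sublists (drop k xs) →
  ∃[ ixs ] AllPairs _<_ ixs × All (k ≤_) ixs × All (_< length xs) ixs × map (nth xs) ixs ≡ s
∈-sublists⁻ xs {s = []} _ = [] , [] , [] , [] , refl
∈-sublists⁻ xs {s = a ∷ s} a∷s∈ with ∷∈sublists-drop⁻ xs a∷s∈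
... | p , k≤p , p<n , refl , s∈ with ∈-sublists⁻ xs s∈
...   | ixs , increasing , p<ixs , ixs<n , refl =
  p ∷ ixs , p<ixs ∷ increasing , k≤p ∷ All.map (λ p<i → ≤-trans k≤p (<⇒≤ p<i)) p<ixs , p<n ∷ ixs<n , refl

-- Restricted permutations

-- Only injectivity is asked for: on a word of length n it already gives a permutation (entry-onto).
record Restricted (x : ℕ → ℕ) (n : ℕ) : Set where
  field
    injective : ∀ p q → p < q → q < n → x p ≢ x q
    fishburn  : ∀ i j → suc i < n → i < j → j < n → x i ≡ suc (x j) → x i ≮ x (suc i)
    avoid321  : ∀ p q r → p < q → q < r → r < n → x r < x q → x q ≮ x p
    avoid2143 : ∀ p q r s → p < q → q < r → r < s → s < n → x q < x p → x p < x s → x s ≮ x r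
    avoid4123 : ∀ p q r s → p < q → q < r → r < s → s < n → x q < x r → x r < x s → x s ≮ x p

restricted-empty : ∀ {x} → Restricted x 0
restricted-empty = record
  { injective = λ _ _ _ ()
  ; fishburn  = λ _ _ ()
  ; avoid321  = λ _ _ _ _ _ ()
  ; avoid2143 = λ _ _ _ _ _ _ _ ()
  ; avoid4123 = λ _ _ _ _ _ _ _ ()
  }

Restricted-cong : ∀ {x y n} → (∀ {p} → p < n → x p ≡ y p) → Restricted x n → Restricted y n
Restricted-cong {x} {y} {n} x≗y R = record
  { injective = λ p q p<q q<n eq →
      injective p q p<q q<n (trans (x≗y (<-trans p<q q<n)) (trans eq (sym (x≗y q<n))))
  ; fishburn  = λ i j 1+i<n i<j j<n eq lt →
      let i<n = <-trans (n<1+n i) 1+i<n in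
      fishburn i j 1+i<n i<j j<n (trans (x≗y i<n) (trans eq (cong suc (sym (x≗y j<n))))) (lt′ i<n 1+i<n lt)
  ; avoid321  = λ p q r p<q q<r r<n l₁ l₂ →
      let q<n = <-trans q<r r<n ; p<n = <-trans p<q q<n in
      avoid321 p q r p<q q<r r<n (lt′ r<n q<n l₁) (lt′ q<n p<n l₂)
  ; avoid2143 = λ p q r s p<q q<r r<s s<n l₁ l₂ l₃ →
      let r<n = <-trans r<s s<n ; q<n = <-trans q<r r<n ; p<n = <-trans p<q q<n in
      avoid2143 p q r s p<q q<r r<s s<n (lt′ q<n p<n l₁) (lt′ p<n s<n l₂) (lt′ s<n r<n l₃)
  ; avoid4123 = λ p q r s p<q q<r r<s s<n l₁ l₂ l₃ →
      let r<n = <-trans r<s s<n ; q<n = <-trans q<r r<n ; p<n = <-trans p<q q<n in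
      avoid4123 p q r s p<q q<r r<s s<n (lt′ q<n r<n l₁) (lt′ r<n s<n l₂) (lt′ s<n p<n l₃)
  }
  where
  open Restricted R
  lt′ : ∀ {p q} → p < n → q < n → y p < y q → x p < x q
  lt′ p<n q<n = subst₂ _<_ (sym (x≗y p<n)) (sym (x≗y q<n))

1⊕_ : (ℕ → ℕ) → ℕ → ℕ
(1⊕ x) zero    = zero
(1⊕ x) (suc p) = suc (x p)

Restricted-1⊕⁺ : ∀ {x n} → Restricted x n → Restricted (1⊕ x) (suc n)
Restricted-1⊕⁺ {x} {n} R = record
  { injective = injective′ ; fishburn = fishburn′ ; avoid321 = avoid321′ ; avoid2143 = avoid2143′ ; avoid4123 = avoid4123′ }
  where
  open Restricted R
  injective′ : ∀ p q → p < q → q < suc n → (1⊕ x) p ≢ (1⊕ x) q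
  injective′ zero    (suc q) _         _         ()
  injective′ (suc p) (suc q) (s≤s p<q) (s≤s q<n) eq = injective p q p<q q<n (suc-injective eq)
  fishburn′ : ∀ i j → suc i < suc n → i < j → j < suc n → (1⊕ x) i ≡ suc ((1⊕ x) j) → (1⊕ x) i ≮ (1⊕ x) (suc i)
  fishburn′ zero    _       _ _ _ ()
  fishburn′ (suc i) (suc j) (s≤s 1+i<n) (s≤s i<j) (s≤s j<n) eq (s≤s lt) = fishburn i j 1+i<n i<j j<n (suc-injective eq) lt
  avoid321′ : ∀ p q r → p < q → q < r → r < suc n → (1⊕ x) r < (1⊕ x) q → (1⊕ x) q ≮ (1⊕ x) p
  avoid321′ zero    _       _       _ _ _ _ ()
  avoid321′ (suc p) (suc q) (suc r) (s≤s p<q) (s≤s q<r) (s≤s r<n) (s≤s l₁) (s≤s l₂) =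
    avoid321 p q r p<q q<r r<n l₁ l₂
  avoid2143′ : ∀ p q r s → p < q → q < r → r < s → s < suc n →
               (1⊕ x) q < (1⊕ x) p → (1⊕ x) p < (1⊕ x) s → (1⊕ x) s ≮ (1⊕ x) r
  avoid2143′ zero    _       _       _       _ _ _ _ () _ _
  avoid2143′ (suc p) (suc q) (suc r) (suc s) (s≤s p<q) (s≤s q<r) (s≤s r<s) (s≤s s<n) (s≤s l₁) (s≤s l₂) (s≤s l₃) =
    avoid2143 p q r s p<q q<r r<s s<n l₁ l₂ l₃
  avoid4123′ : ∀ p q r s → p < q → q < r → r < s → s < suc n →
               (1⊕ x) q < (1⊕ x) r → (1⊕ x) r < (1⊕ x) s → (1⊕ x) s ≮ (1⊕ x) p
  avoid4123′ zero    _       _       _       _ _ _ _ _ _ ()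
  avoid4123′ (suc p) (suc q) (suc r) (suc s) (s≤s p<q) (s≤s q<r) (s≤s r<s) (s≤s s<n) (s≤s l₁) (s≤s l₂) (s≤s l₃) =
    avoid4123 p q r s p<q q<r r<s s<n l₁ l₂ l₃

Restricted-1⊕⁻ : ∀ {x n} → Restricted (1⊕ x) (suc n) → Restricted x n
Restricted-1⊕⁻ R = record
  { injective = λ p q p<q q<n eq → injective (suc p) (suc q) (s≤s p<q) (s≤s q<n) (cong suc eq)
  ; fishburn  = λ i j 1+i<n i<j j<n eq lt →
      fishburn (suc i) (suc j) (s≤s 1+i<n) (s≤s i<j) (s≤s j<n) (cong suc eq) (s≤s lt)
  ; avoid321  = λ p q r p<q q<r r<n l₁ l₂ →
      avoid321 (suc p) (suc q) (suc r) (s≤s p<q) (s≤s q<r) (s≤s r<n) (s≤s l₁) (s≤s l₂)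
  ; avoid2143 = λ p q r s p<q q<r r<s s<n l₁ l₂ l₃ →
      avoid2143 (suc p) (suc q) (suc r) (suc s) (s≤s p<q) (s≤s q<r) (s≤s r<s) (s≤s s<n) (s≤s l₁) (s≤s l₂) (s≤s l₃)
  ; avoid4123 = λ p q r s p<q q<r r<s s<n l₁ l₂ l₃ →
      avoid4123 (suc p) (suc q) (suc r) (suc s) (s≤s p<q) (s≤s q<r) (s≤s r<s) (s≤s s<n) (s≤s l₁) (s≤s l₂) (s≤s l₃)
  }
  where open Restricted R

swap01 : ℕ → ℕ
swap01 zero          = 1
swap01 (suc zero)    = 0
swap01 (suc (suc p)) = suc (suc p)

swap01-inversion : ∀ {p r} → p < r → swap01 r ≤ swap01 p → p ≡ 0 × r ≡ 1
swap01-inversion {zero}        {suc zero}    _   _         = refl , refl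
swap01-inversion {zero}        {suc (suc r)} _   (s≤s ())
swap01-inversion {suc zero}    {suc (suc r)} _   ()
swap01-inversion {suc (suc p)} {suc (suc r)} p<r r≤p       = ⊥-elim (<⇒≱ p<r r≤p)
swap01-inversion {suc _}       {suc zero}    (s≤s ()) _

swap01-restricted : ∀ n → Restricted swap01 n
swap01-restricted n = record
  { injective = injective′ ; fishburn = fishburn′ ; avoid321 = avoid321′ ; avoid2143 = avoid2143′ ; avoid4123 = avoid4123′ }
  where
  injective′ : ∀ p q → p < q → q < n → swap01 p ≢ swap01 q
  injective′ p q p<q _ eq with swap01-inversion p<q (≤-reflexive (sym eq))
  ... | refl , refl = 1+n≢0 eq
  fishburn′ : ∀ i j → suc i < n → i < j → j < n → swap01 i ≡ suc (swap01 j) → swap01 i ≮ swap01 (suc i)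
  fishburn′ i j _ i<j _ eq lt with swap01-inversion i<j (<⇒≤ (subst (swap01 j <_) (sym eq) (n<1+n _)))
  ... | refl , refl = n≮0 lt
  avoid321′ : ∀ p q r → p < q → q < r → r < n → swap01 r < swap01 q → swap01 q ≮ swap01 p
  avoid321′ p q r p<q q<r _ l₁ l₂ with swap01-inversion q<r (<⇒≤ l₁) | swap01-inversion p<q (<⇒≤ l₂)
  ... | refl , _ | _ , ()
  avoid2143′ : ∀ p q r s → p < q → q < r → r < s → s < n →
               swap01 q < swap01 p → swap01 p < swap01 s → swap01 s ≮ swap01 r
  avoid2143′ p q r s p<q q<r r<s _ l₁ _ l₃ with swap01-inversion p<q (<⇒≤ l₁) | swap01-inversion r<s (<⇒≤ l₃)
  ... | refl , refl | refl , _ = n≮0 q<r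
  avoid4123′ : ∀ p q r s → p < q → q < r → r < s → s < n →
               swap01 q < swap01 r → swap01 r < swap01 s → swap01 s ≮ swap01 p
  avoid4123′ p q r s p<q q<r r<s _ _ _ l₃ with swap01-inversion (<-trans p<q (<-trans q<r r<s)) (<⇒≤ l₃)
  ... | refl , refl = n≮0 (<-≤-trans q<r (≤-pred r<s))

-- The cycle (0 2 3 … q 1), i.e. 2 0 3 4 … q 1 q+1 q+2 … in one-line notation.
cycle : ℕ → ℕ → ℕ
cycle q zero            = 2
cycle q (suc zero)      = 0
cycle q p@(suc (suc _)) = if p <ᵇ q then suc p else if p ≡ᵇ q then 1 else p

cycle-cases : ∀ q {p} → 2 ≤ p →
  (p < q × cycle q p ≡ suc p) ⊎ (p ≡ q × cycle q p ≡ 1) ⊎ (q < p × cycle q p ≡ p)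
cycle-cases q {suc zero} (s≤s ())
cycle-cases q {p@(suc (suc _))} _ with <-cmp p q
... | tri< p<q _ _ rewrite <ᵇ-true p<q = inj₁ (p<q , refl)
... | tri≈ p≮q p≡q _ rewrite <ᵇ-false (≮⇒≥ p≮q) | ≡ᵇ-true p≡q = inj₂ (inj₁ (p≡q , refl))
... | tri> _ p≢q q<p rewrite <ᵇ-false (<⇒≤ q<p) | ≡ᵇ-false p≢q = inj₂ (inj₂ (q<p , refl))

cycle-at : ∀ {q} → 2 ≤ q → cycle q q ≡ 1
cycle-at 2≤q with cycle-cases _ 2≤q
... | inj₁ (q<q , _)        = ⊥-elim (<-irrefl refl q<q)
... | inj₂ (inj₁ (_ , c≡1)) = c≡1
... | inj₂ (inj₂ (q<q , _)) = ⊥-elim (<-irrefl refl q<q)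

cycle≡0 : ∀ {q} p → cycle q p ≡ 0 → p ≡ 1
cycle≡0 (suc zero) _ = refl
cycle≡0 {q} (suc (suc p)) eq with cycle-cases q {suc (suc p)} (s≤s (s≤s z≤n))
... | inj₁ (_ , c≡)        = contradiction (trans (sym c≡) eq) λ ()
... | inj₂ (inj₁ (_ , c≡)) = contradiction (trans (sym c≡) eq) λ ()
... | inj₂ (inj₂ (_ , c≡)) = contradiction (trans (sym c≡) eq) λ ()

cycle≡1 : ∀ {q} p → cycle q p ≡ 1 → p ≡ q
cycle≡1 {q} (suc (suc p)) eq with cycle-cases q {suc (suc p)} (s≤s (s≤s z≤n))
... | inj₁ (_ , c≡)          = contradiction (trans (sym c≡) eq) λ ()
... | inj₂ (inj₁ (p≡q , _)) = p≡q
... | inj₂ (inj₂ (_ , c≡))   = contradiction (trans (sym c≡) eq) λ ()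

cycle≡2 : ∀ {q} → 2 ≤ q → ∀ p → cycle q p ≡ 2 → p ≡ 0
cycle≡2 _ zero _ = refl
cycle≡2 {q} 2≤q (suc (suc p)) eq with cycle-cases q {suc (suc p)} (s≤s (s≤s z≤n))
... | inj₁ (_ , c≡)          = contradiction (trans (sym c≡) eq) λ ()
... | inj₂ (inj₁ (_ , c≡))   = contradiction (trans (sym c≡) eq) λ ()
... | inj₂ (inj₂ (q<p , c≡)) = contradiction (≤-<-trans 2≤q (subst (q <_) (trans (sym c≡) eq) q<p)) (<-irrefl refl)

cycle<-below : ∀ {q p r} → 2 ≤ r → r < q → p < r → cycle q p ≤ r
cycle<-below {p = zero}          2≤r _   _   = 2≤r
cycle<-below {p = suc zero}      _   _   _   = z≤n
cycle<-below {q} {p@(suc (suc _))} _ r<q p<r with cycle-cases q {p} (s≤s (s≤s z≤n))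
... | inj₁ (_ , c≡)          = subst (_≤ _) (sym c≡) p<r
... | inj₂ (inj₁ (p≡q , _))  = contradiction (<-trans (subst (_< _) p≡q p<r) r<q) (<-irrefl refl)
... | inj₂ (inj₂ (q<p , _))  = contradiction (<-trans q<p (<-trans p<r r<q)) (<-irrefl refl)

cycle<-above : ∀ {q p r} → 2 ≤ q → q < r → p < r → cycle q p < r
cycle<-above {p = zero}          2≤q q<r _   = ≤-<-trans 2≤q q<r
cycle<-above {p = suc zero}      _   q<r _   = ≤-<-trans z≤n q<r
cycle<-above {q} {p@(suc (suc _))} 2≤q q<r p<r with cycle-cases q {p} (s≤s (s≤s z≤n))
... | inj₁ (p<q , c≡)        = subst (_< _) (sym c≡) (≤-<-trans p<q q<r)
... | inj₂ (inj₁ (_ , c≡))   = subst (_< _) (sym c≡) (<-≤-trans (s≤s (s≤s z≤n)) (<⇒≤ (≤-<-trans 2≤q q<r)))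
... | inj₂ (inj₂ (_ , c≡))   = subst (_< _) (sym c≡) p<r

cycle-inversion : ∀ {q p r} → 2 ≤ q → p < r → cycle q r ≤ cycle q p → r ≡ 1 ⊎ r ≡ q
cycle-inversion {r = suc zero} _ _ _ = inj₁ refl
cycle-inversion {q} {p} {r@(suc (suc _))} 2≤q p<r r≤p with cycle-cases q {r} (s≤s (s≤s z≤n))
... | inj₁ (r<q , c≡)        = contradiction (≤-trans (subst (_≤ _) c≡ r≤p) (cycle<-below (s≤s (s≤s z≤n)) r<q p<r)) 1+n≰n
... | inj₂ (inj₁ (r≡q , _))  = inj₂ r≡q
... | inj₂ (inj₂ (q<r , c≡)) = contradiction (≤-<-trans (subst (_≤ _) c≡ r≤p) (cycle<-above 2≤q q<r p<r)) (<-irrefl refl)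

cycle-restricted : ∀ {q} → 2 ≤ q → ∀ n → Restricted (cycle q) n
cycle-restricted {q} 2≤q n = record
  { injective = injective′
  ; fishburn  = fishburn′
  ; avoid321  = λ p q′ r p<q′ q′<r _ l₁ l₂ →
      let r≡1  = cycle≡0 r (n<1⇒n≡0 (<-≤-trans l₁ (inversion-low p<q′ (<⇒≤ l₂))))
          q′≡0 = n<1⇒n≡0 (subst (q′ <_) r≡1 q′<r)
      in n≮0 (subst (p <_) q′≡0 p<q′)
  ; avoid2143 = λ p q′ r s p<q′ q′<r r<s _ l₁ l₂ l₃ →
      n≮0 (<-≤-trans l₁ (≤-pred (<-≤-trans l₂ (inversion-low r<s (<⇒≤ l₃)))))
  ; avoid4123 = λ p q′ r s p<q′ q′<r r<s _ l₁ l₂ l₃ →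
      n≮0 (<-≤-trans l₁ (≤-pred (<-≤-trans l₂ (inversion-low (<-trans p<q′ (<-trans q′<r r<s)) (<⇒≤ l₃)))))
  }
  where
  inversion-low : ∀ {p r} → p < r → cycle q r ≤ cycle q p → cycle q r ≤ 1
  inversion-low p<r r≤p with cycle-inversion 2≤q p<r r≤p
  ... | inj₁ refl = z≤n
  ... | inj₂ refl = ≤-reflexive (cycle-at 2≤q)
  injective′ : ∀ p r → p < r → r < n → cycle q p ≢ cycle q r
  injective′ p r p<r _ eq with cycle-inversion 2≤q p<r (≤-reflexive (sym eq))
  ... | inj₁ refl = <-irrefl (cycle≡0 p eq) p<r
  ... | inj₂ refl = <-irrefl (cycle≡1 p (trans eq (cycle-at 2≤q))) p<r
  fishburn′ : ∀ i j → suc i < n → i < j → j < n → cycle q i ≡ suc (cycle q j) → cycle q i ≮ cycle q (suc i)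
  fishburn′ i j _ i<j _ eq lt with cycle-inversion 2≤q i<j (<⇒≤ (subst (cycle q j <_) (sym eq) (n<1+n _)))
  ... | inj₁ refl = <⇒≱ (subst (_< 1) (cycle≡1 i eq) i<j) (≤-trans (s≤s z≤n) 2≤q)
  ... | inj₂ refl with cycle≡2 2≤q i (trans eq (cong suc (cycle-at 2≤q)))
  ...   | refl = n≮0 lt

skip : ℕ → ℕ → ℕ
skip q d = if 2 + d <ᵇ q then 2 + d else 3 + d

skip-below : ∀ {q d} → 2 + d < q → skip q d ≡ 2 + d
skip-below 2+d<q rewrite <ᵇ-true 2+d<q = refl

skip-above : ∀ {q d} → q ≤ 2 + d → skip q d ≡ 3 + d
skip-above q≤2+d rewrite <ᵇ-false q≤2+d = refl

skip-cases : ∀ q d → (2 + d < q × skip q d ≡ 2 + d) ⊎ (q ≤ 2 + d × skip q d ≡ 3 + d)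
skip-cases q d with 2 + d <? q
... | yes 2+d<q = inj₁ (2+d<q , skip-below 2+d<q)
... | no 2+d≮q  = inj₂ (≮⇒≥ 2+d≮q , skip-above (≮⇒≥ 2+d≮q))

skip-≥2 : ∀ q d → 2 ≤ skip q d
skip-≥2 q d with skip-cases q d
... | inj₁ (_ , eq) = subst (2 ≤_) (sym eq) (s≤s (s≤s z≤n))
... | inj₂ (_ , eq) = subst (2 ≤_) (sym eq) (s≤s (s≤s z≤n))

skip-≤ : ∀ q d → skip q d ≤ 3 + d
skip-≤ q d with skip-cases q d
... | inj₁ (_ , eq) = subst (_≤ 3 + d) (sym eq) (n≤1+n _)
... | inj₂ (_ , eq) = ≤-reflexive eq

skip-≢ : ∀ q d → skip q d ≢ q
skip-≢ q d with skip-cases q d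
... | inj₁ (2+d<q , eq) = λ skip≡q → <-irrefl (trans (sym eq) skip≡q) 2+d<q
... | inj₂ (q≤2+d , eq) = λ skip≡q → <-irrefl (sym (trans (sym eq) skip≡q)) (s≤s q≤2+d)

skip-increasing : ∀ q {d e} → d < e → skip q d < skip q e
skip-increasing q {d} {e} d<e with skip-cases q d | skip-cases q e
... | inj₁ (_ , eq₁)       | inj₁ (_ , eq₂)       = subst₂ _<_ (sym eq₁) (sym eq₂) (s≤s (s≤s d<e))
... | inj₁ (_ , eq₁)       | inj₂ (_ , eq₂)       = subst₂ _<_ (sym eq₁) (sym eq₂) (s≤s (s≤s (<⇒≤ (s≤s d<e))))
... | inj₂ (q≤2+d , _)     | inj₁ (2+e<q , _)     = contradiction (<-≤-trans 2+e<q (≤-trans q≤2+d (<⇒≤ (s≤s (s≤s d<e))))) (<-irrefl refl)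
... | inj₂ (_ , eq₁)       | inj₂ (_ , eq₂)       = subst₂ _<_ (sym eq₁) (sym eq₂) (s≤s (s≤s (s≤s d<e)))

-- Classification by the first entry

increasing⇒+-≤ : ∀ {L} (g : ℕ → ℕ) → (∀ {d e} → d < e → e < L → g d < g e) →
                 ∀ d k → k + d < L → g d + k ≤ g (k + d)
increasing⇒+-≤ g increasing d zero    _       = ≤-reflexive (+-identityʳ (g d))
increasing⇒+-≤ g increasing d (suc k) 1+k+d<L = begin
  g d + suc k     ≡⟨ +-suc (g d) k ⟩
  suc (g d + k)   ≤⟨ s≤s (increasing⇒+-≤ g increasing d k (<-trans (n<1+n _) 1+k+d<L)) ⟩
  suc (g (k + d)) ≤⟨ increasing (n<1+n (k + d)) 1+k+d<L ⟩
  g (suc k + d)   ∎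
  where open ≤-Reasoning

increasing-squeeze : ∀ (g : ℕ → ℕ) c L → (∀ {d e} → d < e → e < L → g d < g e) →
                     (∀ {d} → d < L → c ≤ g d) → (∀ {d} → d < L → g d < c + L) →
                     ∀ {d} → d < L → g d ≡ c + d
increasing-squeeze g c L increasing lower upper {d} d<L = ≤-antisym g≤c+d c+d≤g
  where
  0<L : 0 < L
  0<L = ≤-<-trans z≤n d<L
  c+d≤g : c + d ≤ g d
  c+d≤g = begin
    c + d     ≤⟨ +-monoˡ-≤ d (lower 0<L) ⟩
    g 0 + d   ≤⟨ increasing⇒+-≤ g increasing 0 d (subst (_< L) (sym (+-identityʳ d)) d<L) ⟩
    g (d + 0) ≡⟨ cong g (+-identityʳ d) ⟩
    g d       ∎
    where open ≤-Reasoning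
  g≤c+d : g d ≤ c + d
  g≤c+d with m≤n⇒∃[o]m+o≡n d<L
  ... | k , 1+d+k≡L = +-cancelʳ-≤ k (g d) (c + d) (begin
    g d + k       ≤⟨ increasing⇒+-≤ g increasing d k k+d<L ⟩
    g (k + d)     ≤⟨ ≤-pred (subst (g (k + d) <_) c+L≡ (upper k+d<L)) ⟩
    c + (k + d)   ≡⟨ cong (c +_) (+-comm k d) ⟩
    c + (d + k)   ≡⟨ sym (+-assoc c d k) ⟩
    c + d + k     ∎)
    where
    open ≤-Reasoning
    k+d<L : k + d < L
    k+d<L = subst (_< L) (+-comm d k) (≤-reflexive 1+d+k≡L)
    c+L≡ : c + L ≡ suc (c + (k + d))
    c+L≡ = trans (cong (c +_) (trans (sym 1+d+k≡L) (cong suc (+-comm d k)))) (+-suc c (k + d))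

Bounded : (ℕ → ℕ) → ℕ → Set
Bounded x n = ∀ {p} → p < n → x p < n

Onto : (ℕ → ℕ) → ℕ → Set
Onto x n = ∀ {v} → v < n → ∃[ p ] p < n × x p ≡ v

module FirstEntry {x : ℕ → ℕ} {n : ℕ}
  (R : Restricted x (suc n)) (bounded : Bounded x (suc n)) (onto : Onto x (suc n)) where

  open Restricted R

  same-value⇒same-position : ∀ {p q} → p < suc n → q < suc n → x p ≡ x q → p ≡ q
  same-value⇒same-position {p} {q} p<n q<n eq with <-cmp p q
  ... | tri< p<q _ _ = ⊥-elim (injective p q p<q q<n eq)
  ... | tri≈ _ p≡q _ = p≡q
  ... | tri> _ _ q<p = ⊥-elim (injective q p q<p p<n (sym eq))

  beyond-first-two : ∀ {p} → x p ≢ x 0 → x p ≢ x 1 → 2 ≤ p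
  beyond-first-two {zero}        ≢x0 _   = ⊥-elim (≢x0 refl)
  beyond-first-two {suc zero}    _   ≢x1 = ⊥-elim (≢x1 refl)
  beyond-first-two {suc (suc _)} _   _   = s≤s (s≤s z≤n)

  positive : ∀ {q} → x q < x 0 → 0 < q
  positive {zero}  xq<x0 = contradiction xq<x0 (<-irrefl refl)
  positive {suc _} _     = z<s

  -- Otherwise the first entry, x q and x p would form a 321.
  below-first-increasing : ∀ {p q} → p < suc n → x p < x q → x q < x 0 → p < q
  below-first-increasing {p} {q} p<n xp<xq xq<x0 with <-cmp p q
  ... | tri< p<q _ _ = p<q
  ... | tri≈ _ refl _ = contradiction xp<xq (<-irrefl refl)
  ... | tri> _ _ q<p = ⊥-elim (avoid321 0 q p (positive xq<x0) q<p p<n xp<xq xq<x0)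

  -- The values 0, 1, 2 would come after the first entry in increasing order, forming a 4123.
  first≤2 : x 0 ≤ 2
  first≤2 = ≮⇒≥ λ 2<x0 →
    let x0<n = bounded {0} z<s
        1<x0 = <-trans ≤-refl 2<x0
        p₀ , p₀<n , xp₀≡0 = onto (<-trans (<-trans z<s 1<x0) x0<n)
        p₁ , p₁<n , xp₁≡1 = onto (<-trans 1<x0 x0<n)
        p₂ , p₂<n , xp₂≡2 = onto (<-trans 2<x0 x0<n)
        xp₀<xp₁ = subst₂ _<_ (sym xp₀≡0) (sym xp₁≡1) z<s
        xp₁<xp₂ = subst₂ _<_ (sym xp₁≡1) (sym xp₂≡2) ≤-refl
        xp₂<x0  = subst (_< x 0) (sym xp₂≡2) 2<x0
    in avoid4123 0 p₀ p₁ p₂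
         (positive (<-trans xp₀<xp₁ (<-trans xp₁<xp₂ xp₂<x0)))
         (below-first-increasing p₀<n xp₀<xp₁ (<-trans xp₁<xp₂ xp₂<x0))
         (below-first-increasing p₁<n xp₁<xp₂ xp₂<x0)
         p₂<n xp₀<xp₁ xp₁<xp₂ xp₂<x0

  -- A larger second entry breaks the Fishburn condition at the later value x 0 − 1;
  -- a smaller nonzero one forms a 321 with the later 0.
  second≡0 : ∀ {v} → x 0 ≡ suc v → x 1 ≡ 0
  second≡0 {v} x0≡1+v = by-cases (<-cmp (x 1) (x 0))
    where
    1+v<n : suc v < suc n
    1+v<n = subst (_< suc n) x0≡1+v (bounded z<s)
    1<n : 1 < suc n
    1<n = ≤-trans (s≤s (s≤s z≤n)) 1+v<n
    by-cases : Tri (x 1 < x 0) (x 1 ≡ x 0) (x 0 < x 1) → x 1 ≡ 0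
    by-cases (tri< x1<x0 _ _) = n≤0⇒n≡0 (≮⇒≥ λ 0<x1 →
      let p , p<n , xp≡0 = onto {0} z<s
          p≡0 = n<1⇒n≡0 (below-first-increasing p<n (subst (_< x 1) (sym xp≡0) 0<x1) x1<x0)
      in 1+n≢0 (trans (sym x0≡1+v) (trans (cong x (sym p≡0)) xp≡0)))
    by-cases (tri≈ _ x1≡x0 _) = ⊥-elim (injective 0 1 z<s 1<n (sym x1≡x0))
    by-cases (tri> _ _ x0<x1) =
      let j , j<n , xj≡v = onto {v} (<-trans (n<1+n v) 1+v<n)
          xj<x0 = subst₂ _<_ (sym xj≡v) (sym x0≡1+v) (n<1+n v)
      in ⊥-elim (fishburn 0 j 1<n (positive xj<x0) j<n (trans x0≡1+v (cong suc (sym xj≡v))) x0<x1)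

  -- Otherwise x 0, x 1, x p, x r would form a 2143.
  increasing-after-descent : x 1 < x 0 → ∀ {p r} → 2 ≤ p → p < r → r < suc n → x 0 < x r → x p < x r
  increasing-after-descent x1<x0 {p} {r} 2≤p p<r r<n x0<xr with <-cmp (x p) (x r)
  ... | tri< xp<xr _ _ = xp<xr
  ... | tri≈ _ xp≡xr _ = ⊥-elim (injective p r p<r r<n xp≡xr)
  ... | tri> _ _ xr<xp = ⊥-elim (avoid2143 0 1 p r z<s 2≤p p<r r<n x1<x0 x0<xr xr<xp)

first≡1⇒swap01 : ∀ {m x} → Restricted x (2 + m) → Bounded x (2 + m) → Onto x (2 + m) → x 0 ≡ 1 →
                 ∀ {p} → p < 2 + m → x p ≡ swap01 p
first≡1⇒swap01 {m} {x} R bounded onto x0≡1 = agree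
  where
  open Restricted R
  open FirstEntry R bounded onto
  x1≡0 : x 1 ≡ 0
  x1≡0 = second≡0 x0≡1
  ≥2 : ∀ {p} → 2 ≤ p → p < 2 + m → 2 ≤ x p
  ≥2 {p} 2≤p p<n with x p in xp≡
  ... | zero        = ⊥-elim (injective 1 p 2≤p p<n (trans x1≡0 (sym xp≡)))
  ... | suc zero    = ⊥-elim (injective 0 p (<-trans z<s 2≤p) p<n (trans x0≡1 (sym xp≡)))
  ... | suc (suc _) = s≤s (s≤s z≤n)
  shifted : ∀ {d} → d < m → x (2 + d) ≡ 2 + d
  shifted = increasing-squeeze (λ d → x (2 + d)) 2 m
    (λ {_} {e} d<e e<m → increasing-after-descent (subst₂ _<_ (sym x1≡0) (sym x0≡1) z<s)
      (s≤s (s≤s z≤n)) (s≤s (s≤s d<e)) (s≤s (s≤s e<m))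
      (subst (_< x (2 + e)) (sym x0≡1) (≥2 (s≤s (s≤s z≤n)) (s≤s (s≤s e<m)))))
    (λ d<m → ≥2 (s≤s (s≤s z≤n)) (s≤s (s≤s d<m)))
    (λ d<m → bounded (s≤s (s≤s d<m)))
  agree : ∀ {p} → p < 2 + m → x p ≡ swap01 p
  agree {zero}        _                = x0≡1
  agree {suc zero}    _                = x1≡0
  agree {suc (suc d)} (s≤s (s≤s d<m)) = shifted d<m

first≡2⇒cycle : ∀ {m x} → Restricted x (3 + m) → Bounded x (3 + m) → Onto x (3 + m) → x 0 ≡ 2 →
                ∃[ q ] 2 ≤ q × q < 3 + m × (∀ {p} → p < 3 + m → x p ≡ cycle q p)
first≡2⇒cycle {m} {x} R bounded onto x0≡2 with onto {1} (s≤s (s≤s z≤n))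
... | q , q<n , xq≡1 = q , 2≤q , q<n , agree
  where
  open Restricted R
  open FirstEntry R bounded onto
  x1≡0 : x 1 ≡ 0
  x1≡0 = second≡0 x0≡2
  2≤q : 2 ≤ q
  2≤q = beyond-first-two (λ eq → contradiction (trans (sym xq≡1) (trans eq x0≡2)) λ ())
                         (λ eq → contradiction (trans (sym xq≡1) (trans eq x1≡0)) λ ())
  ≥3 : ∀ {p} → 2 ≤ p → p < 3 + m → p ≢ q → 3 ≤ x p
  ≥3 {p} 2≤p p<n p≢q with x p in xp≡
  ... | zero              = ⊥-elim (injective 1 p 2≤p p<n (trans x1≡0 (sym xp≡)))
  ... | suc zero          = ⊥-elim (p≢q (same-value⇒same-position p<n q<n (trans xp≡ (sym xq≡1))))
  ... | suc (suc zero)    = ⊥-elim (injective 0 p (<-trans z<s 2≤p) p<n (trans x0≡2 (sym xp≡)))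
  ... | suc (suc (suc _)) = s≤s (s≤s (s≤s z≤n))
  skip<n : ∀ {d} → d < m → skip q d < 3 + m
  skip<n {d} d<m = ≤-<-trans (skip-≤ q d) (s≤s (s≤s (s≤s d<m)))
  shifted : ∀ {d} → d < m → x (skip q d) ≡ 3 + d
  shifted = increasing-squeeze (x ∘ skip q) 3 m
    (λ {d} {e} d<e e<m → increasing-after-descent (subst₂ _<_ (sym x1≡0) (sym x0≡2) z<s)
      (skip-≥2 q d) (skip-increasing q d<e) (skip<n e<m)
      (subst (_< x (skip q e)) (sym x0≡2) (≥3 (skip-≥2 q e) (skip<n e<m) (skip-≢ q e))))
    (λ {d} d<m → ≥3 (skip-≥2 q d) (skip<n d<m) (skip-≢ q d))
    (λ d<m → bounded (skip<n d<m))
  after-q : ∀ d → 2 + d < 3 + m → q < 2 + d → x (2 + d) ≡ 2 + d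
  after-q zero     _                       q<2   = contradiction (<-≤-trans q<2 2≤q) (<-irrefl refl)
  after-q (suc d) (s≤s (s≤s (s≤s d<m))) q<3+d = trans (cong x (sym (skip-above (≤-pred q<3+d)))) (shifted d<m)
  agree : ∀ {p} → p < 3 + m → x p ≡ cycle q p
  agree {zero}        _   = x0≡2
  agree {suc zero}    _   = x1≡0
  agree {suc (suc d)} p<n with cycle-cases q {suc (suc d)} (s≤s (s≤s z≤n))
  ... | inj₁ (p<q , c≡)        =
    trans (cong x (sym (skip-below p<q))) (trans (shifted (≤-pred (≤-pred (≤-trans p<q (≤-pred q<n))))) (sym c≡))
  ... | inj₂ (inj₁ (p≡q , c≡)) = trans (cong x p≡q) (trans xq≡1 (sym c≡))
  ... | inj₂ (inj₂ (q<p , c≡)) = trans (after-q d p<n q<p) (sym c≡)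

entries : ∀ {k m} → Vec (Fin k) m → List ℕ
entries w = map toℕ (toList w)

entry : ∀ {k m} → Vec (Fin k) m → ℕ → ℕ
entry w = nth (entries w)

length-entries : ∀ {k m} (w : Vec (Fin k) m) → length (entries w) ≡ m
length-entries w = trans (length-map toℕ (toList w)) (Vecₚ.length-toList w)

entry-lookup : ∀ {k m} (w : Vec (Fin k) m) i → entry w (toℕ i) ≡ toℕ (lookup w i)
entry-lookup (_ ∷ _) Fin.zero    = refl
entry-lookup (_ ∷ w) (Fin.suc i) = entry-lookup w i

entry-val : ∀ {n} (w : Word n) {p} (p<n : p < n) → entry w p ≡ val w (fromℕ< p<n)
entry-val w p<n = trans (cong (entry w) (sym (Finₚ.toℕ-fromℕ< p<n))) (entry-lookup w (fromℕ< p<n))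

entry-ext : ∀ {k m} {u v : Vec (Fin k) m} → (∀ {p} → p < m → entry u p ≡ entry v p) → u ≡ v
entry-ext {u = []}    {[]}    _  = refl
entry-ext {u = _ ∷ _} {_ ∷ _} eq = cong₂ _∷_ (Finₚ.toℕ-injective (eq z<s)) (entry-ext (λ p<m → eq (s≤s p<m)))

entry-bounded : ∀ {n} (w : Word n) → Bounded (entry w) n
entry-bounded w p<n = subst (_< _) (sym (entry-val w p<n)) (Finₚ.toℕ<n _)

entry-onto : ∀ {n} (w : Word n) → (∀ p q → p < q → q < n → entry w p ≢ entry w q) → Onto (entry w) n
entry-onto {zero}  _ _   ()
entry-onto {suc m} w inj {v} v<n with Finₚ.any? (λ i → lookup w i Finₚ.≟ fromℕ< v<n)
... | yes (i , wi≡v) = toℕ i , Finₚ.toℕ<n i , trans (entry-lookup w i) (trans (cong toℕ wi≡v) (Finₚ.toℕ-fromℕ< v<n))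
... | no ∄i = contradiction (Finₚ.injective⇒≤ punched-injective) 1+n≰n
  where
  lookup-injective : ∀ {i j} → lookup w i ≡ lookup w j → i ≡ j
  lookup-injective {i} {j} eq with <-cmp (toℕ i) (toℕ j)
  ... | tri< i<j _ _ = ⊥-elim (inj _ _ i<j (Finₚ.toℕ<n j)
                         (trans (entry-lookup w i) (trans (cong toℕ eq) (sym (entry-lookup w j)))))
  ... | tri≈ _ i≡j _ = Finₚ.toℕ-injective i≡j
  ... | tri> _ _ j<i = ⊥-elim (inj _ _ j<i (Finₚ.toℕ<n i)
                         (trans (entry-lookup w j) (trans (cong toℕ (sym eq)) (sym (entry-lookup w i)))))
  -- v is not hit, so lookup w injects Fin (suc m) into Fin m.
  v≢ : ∀ i → fromℕ< v<n ≢ lookup w i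
  v≢ i v≡wi = ∄i (i , sym v≡wi)
  punched : Fin (suc m) → Fin m
  punched i = punchOut (v≢ i)
  punched-injective : ∀ {i j} → punched i ≡ punched j → i ≡ j
  punched-injective {i} {j} eq = lookup-injective (Finₚ.punchOut-injective (v≢ i) (v≢ j) eq)

T-isPerm : ∀ {n} (w : Word n) → T (isPerm w) ⇔ (∀ p q → p < q → q < n → entry w p ≢ entry w q)
T-isPerm {n} w = mk⇔
  (λ t p q p<q q<n eq →
    let p<n = <-trans p<q q<n
        i<j = subst₂ _<_ (sym (Finₚ.toℕ-fromℕ< p<n)) (sym (Finₚ.toℕ-fromℕ< q<n)) p<q
        t′  = to T-allFin (to T-allFin t (fromℕ< p<n)) (fromℕ< q<n)
    in T-not⁻ (to T-⇒ᵇ t′ (<⇒<ᵇ i<j)) (≡⇒≡ᵇ _ _ (trans (sym (entry-val w p<n)) (trans eq (entry-val w q<n)))))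
  (λ inj → from T-allFin λ i → from T-allFin λ j → from T-⇒ᵇ λ i<j → T-not⁺ λ eq →
    inj (toℕ i) (toℕ j) (<ᵇ⇒< _ _ i<j) (Finₚ.toℕ<n j)
      (trans (entry-lookup w i) (trans (≡ᵇ⇒≡ _ _ eq) (sym (entry-lookup w j)))))

T-isFishburn : ∀ {n} (w : Word n) → T (isFishburn w) ⇔
  (∀ i j → suc i < n → i < j → j < n → entry w i ≡ suc (entry w j) → entry w i ≮ entry w (suc i))
T-isFishburn {n} w = mk⇔
  (λ t i j 1+i<n i<j j<n eq lt →
    let i<n = <-trans (n<1+n i) 1+i<n
        I = fromℕ< i<n ; I′ = fromℕ< 1+i<n ; J = fromℕ< j<n
        eI = entry-val w i<n ; eI′ = entry-val w 1+i<n ; eJ = entry-val w j<n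
    in T-not⁻ t (from T-anyFin (I , from T-anyFin (I′ , from T-anyFin (J ,
         ≡⇒≡ᵇ _ _ (trans (Finₚ.toℕ-fromℕ< 1+i<n) (cong suc (sym (Finₚ.toℕ-fromℕ< i<n))))
      ∧ᵀ <⇒<ᵇ (subst₂ _<_ (sym (Finₚ.toℕ-fromℕ< i<n)) (sym (Finₚ.toℕ-fromℕ< j<n)) i<j)
      ∧ᵀ <⇒<ᵇ (subst₂ _<_ eJ eI (subst (entry w j <_) (sym eq) (n<1+n _)))
      ∧ᵀ <⇒<ᵇ (subst₂ _<_ eI eI′ lt)
      ∧ᵀ ≡⇒≡ᵇ _ _ (trans (sym eI) (trans eq (cong suc eJ))))))))
  (λ F → T-not⁺ λ t →
    let I  , t₁ = to T-anyFin t
        I′ , t₂ = to T-anyFin t₁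
        J  , t₃ = to T-anyFin t₂
        c₁ , t₄ = to (T-∧ {toℕ I′ ≡ᵇ suc (toℕ I)}) t₃
        c₂ , t₅ = to (T-∧ {toℕ I <ᵇ toℕ J}) t₄
        c₃ , t₆ = to (T-∧ {val w J <ᵇ val w I}) t₅
        c₄ , c₅ = to (T-∧ {val w I <ᵇ val w I′}) t₆
        I′≡ = ≡ᵇ⇒≡ _ _ c₁
    in F (toℕ I) (toℕ J) (subst (_< n) I′≡ (Finₚ.toℕ<n I′)) (<ᵇ⇒< _ _ c₂) (Finₚ.toℕ<n J)
         (trans (entry-lookup w I) (trans (≡ᵇ⇒≡ _ _ c₅) (cong suc (sym (entry-lookup w J)))))
         (subst₂ _<_ (sym (entry-lookup w I)) (trans (sym (entry-lookup w I′)) (cong (entry w) I′≡)) (<ᵇ⇒< _ _ c₄)))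

Occurrence : ∀ {n} → Word n → List ℕ → Set
Occurrence {n} w pat = ∃[ ixs ] AllPairs _<_ ixs × All (_< n) ixs × T (orderIso (map (entry w) ixs) pat)

T-contains : ∀ {n} (w : Word n) pat → T (contains w pat) ⇔ Occurrence w pat
T-contains {n} w pat = mk⇔
  (λ t →
    let s , s∈ , iso = find (Anyₚ.any⁻ _ _ t)
        ixs , increasing , _ , ixs<len , ixs↦s = ∈-sublists⁻ (entries w) {0} s∈
    in ixs , increasing , All.map (λ {i} → subst (i <_) (length-entries w)) ixs<len
     , subst (λ s → T (orderIso s pat)) (sym ixs↦s) iso)
  (λ (ixs , increasing , ixs<n , iso) → Anyₚ.any⁺ _ (lose
    (∈-sublists⁺ (entries w) increasing (All.universal (λ _ → z≤n) ixs)
      (All.map (λ {i} → subst (i <_) (sym (length-entries w))) ixs<n)) iso))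

T-avoids321 : ∀ {n} (w : Word n) → T (avoids w p321) ⇔
  (∀ p q r → p < q → q < r → r < n → entry w r < entry w q → entry w q ≮ entry w p)
T-avoids321 {n} w = mk⇔
  (λ t p q r p<q q<r r<n l₁ l₂ →
    let q<n = <-trans q<r r<n in
    T-not⁻ t (from (T-contains w p321)
      ( p ∷ q ∷ r ∷ [] , (p<q ∷ <-trans p<q q<r ∷ []) ∷ (q<r ∷ []) ∷ [] ∷ []
      , <-trans p<q q<n ∷ q<n ∷ r<n ∷ [] , from orderIso-321 (l₁ , l₂))))
  (λ avoiding → T-not⁺ λ t → no-occurrence avoiding (to (T-contains w p321) t))
  where
  no-occurrence : (∀ p q r → p < q → q < r → r < n → entry w r < entry w q → entry w q ≮ entry w p) →
                  ¬ Occurrence w p321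
  no-occurrence avoiding (p ∷ q ∷ r ∷ [] , (p<q ∷ _) ∷ (q<r ∷ []) ∷ [] ∷ [] , _ ∷ _ ∷ r<n ∷ [] , iso) =
    let l₁ , l₂ = to orderIso-321 iso in avoiding p q r p<q q<r r<n l₁ l₂
  no-occurrence _ ([] , _ , _ , ())
  no-occurrence _ (_ ∷ [] , _ , _ , ())
  no-occurrence _ (ixs@(_ ∷ _ ∷ []) , _ , _ , iso) = contradiction (orderIso-length (map (entry w) ixs) p321 iso) λ ()
  no-occurrence _ (ixs@(_ ∷ _ ∷ _ ∷ _ ∷ _) , _ , _ , iso) = contradiction (orderIso-length (map (entry w) ixs) p321 iso) λ ()

T-avoids2143 : ∀ {n} (w : Word n) → T (avoids w p2143) ⇔
  (∀ p q r s → p < q → q < r → r < s → s < n →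
     entry w q < entry w p → entry w p < entry w s → entry w s ≮ entry w r)
T-avoids2143 {n} w = mk⇔
  (λ t p q r s p<q q<r r<s s<n l₁ l₂ l₃ →
    let r<n = <-trans r<s s<n ; q<n = <-trans q<r r<n in
    T-not⁻ t (from (T-contains w p2143)
      ( p ∷ q ∷ r ∷ s ∷ []
      , (p<q ∷ <-trans p<q q<r ∷ <-trans p<q (<-trans q<r r<s) ∷ []) ∷ (q<r ∷ <-trans q<r r<s ∷ [])
          ∷ (r<s ∷ []) ∷ [] ∷ []
      , <-trans p<q q<n ∷ q<n ∷ r<n ∷ s<n ∷ [] , from orderIso-2143 (l₁ , l₂ , l₃))))
  (λ avoiding → T-not⁺ λ t → no-occurrence avoiding (to (T-contains w p2143) t))
  where
  no-occurrence : (∀ p q r s → p < q → q < r → r < s → s < n →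
                     entry w q < entry w p → entry w p < entry w s → entry w s ≮ entry w r) →
                  ¬ Occurrence w p2143
  no-occurrence avoiding
    (p ∷ q ∷ r ∷ s ∷ [] , (p<q ∷ _) ∷ (q<r ∷ _) ∷ (r<s ∷ []) ∷ [] ∷ [] , _ ∷ _ ∷ _ ∷ s<n ∷ [] , iso) =
    let l₁ , l₂ , l₃ = to orderIso-2143 iso in avoiding p q r s p<q q<r r<s s<n l₁ l₂ l₃
  no-occurrence _ ([] , _ , _ , ())
  no-occurrence _ (_ ∷ [] , _ , _ , ())
  no-occurrence _ (ixs@(_ ∷ _ ∷ []) , _ , _ , iso) = contradiction (orderIso-length (map (entry w) ixs) p2143 iso) λ ()
  no-occurrence _ (ixs@(_ ∷ _ ∷ _ ∷ []) , _ , _ , iso) = contradiction (orderIso-length (map (entry w) ixs) p2143 iso) λ ()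
  no-occurrence _ (ixs@(_ ∷ _ ∷ _ ∷ _ ∷ _ ∷ _) , _ , _ , iso) = contradiction (orderIso-length (map (entry w) ixs) p2143 iso) λ ()

T-avoids4123 : ∀ {n} (w : Word n) → T (avoids w p4123) ⇔
  (∀ p q r s → p < q → q < r → r < s → s < n →
     entry w q < entry w r → entry w r < entry w s → entry w s ≮ entry w p)
T-avoids4123 {n} w = mk⇔
  (λ t p q r s p<q q<r r<s s<n l₁ l₂ l₃ →
    let r<n = <-trans r<s s<n ; q<n = <-trans q<r r<n in
    T-not⁻ t (from (T-contains w p4123)
      ( p ∷ q ∷ r ∷ s ∷ []
      , (p<q ∷ <-trans p<q q<r ∷ <-trans p<q (<-trans q<r r<s) ∷ []) ∷ (q<r ∷ <-trans q<r r<s ∷ [])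
          ∷ (r<s ∷ []) ∷ [] ∷ []
      , <-trans p<q q<n ∷ q<n ∷ r<n ∷ s<n ∷ [] , from orderIso-4123 (l₁ , l₂ , l₃))))
  (λ avoiding → T-not⁺ λ t → no-occurrence avoiding (to (T-contains w p4123) t))
  where
  no-occurrence : (∀ p q r s → p < q → q < r → r < s → s < n →
                     entry w q < entry w r → entry w r < entry w s → entry w s ≮ entry w p) →
                  ¬ Occurrence w p4123
  no-occurrence avoiding
    (p ∷ q ∷ r ∷ s ∷ [] , (p<q ∷ _) ∷ (q<r ∷ _) ∷ (r<s ∷ []) ∷ [] ∷ [] , _ ∷ _ ∷ _ ∷ s<n ∷ [] , iso) =
    let l₁ , l₂ , l₃ = to orderIso-4123 iso in avoiding p q r s p<q q<r r<s s<n l₁ l₂ l₃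
  no-occurrence _ ([] , _ , _ , ())
  no-occurrence _ (_ ∷ [] , _ , _ , ())
  no-occurrence _ (ixs@(_ ∷ _ ∷ []) , _ , _ , iso) = contradiction (orderIso-length (map (entry w) ixs) p4123 iso) λ ()
  no-occurrence _ (ixs@(_ ∷ _ ∷ _ ∷ []) , _ , _ , iso) = contradiction (orderIso-length (map (entry w) ixs) p4123 iso) λ ()
  no-occurrence _ (ixs@(_ ∷ _ ∷ _ ∷ _ ∷ _ ∷ _) , _ , _ , iso) = contradiction (orderIso-length (map (entry w) ixs) p4123 iso) λ ()

isRestricted : ∀ {n} → Word n → Bool
isRestricted w = isFishburn w ∧ avoids w p321 ∧ avoids w p2143 ∧ avoids w p4123

T-restricted : ∀ {n} (w : Word n) → (T (isPerm w) × T (isRestricted w)) ⇔ Restricted (entry w) n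
T-restricted w = mk⇔
  (λ (perm , t) →
    let fishburn , t′ = to (T-∧ {isFishburn w}) t
        a321 , t″     = to (T-∧ {avoids w p321}) t′
        a2143 , a4123 = to (T-∧ {avoids w p2143}) t″
    in record
      { injective = to (T-isPerm w) perm
      ; fishburn  = to (T-isFishburn w) fishburn
      ; avoid321  = to (T-avoids321 w) a321
      ; avoid2143 = to (T-avoids2143 w) a2143
      ; avoid4123 = to (T-avoids4123 w) a4123
      })
  (λ R → let open Restricted R in
      from (T-isPerm w) injective
    , (from (T-isFishburn w) fishburn ∧ᵀ from (T-avoids321 w) avoid321
       ∧ᵀ from (T-avoids2143 w) avoid2143 ∧ᵀ from (T-avoids4123 w) avoid4123))

-- The enumeration

tabulateWord : ∀ {n} (g : ℕ → ℕ) → Bounded g n → Word n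
tabulateWord g g<n = Vec.tabulate (λ i → fromℕ< (g<n (Finₚ.toℕ<n i)))

entry-tabulateWord : ∀ {n} g (g<n : Bounded g n) {p} → p < n → entry (tabulateWord g g<n) p ≡ g p
entry-tabulateWord g g<n p<n =
  trans (entry-val (tabulateWord g g<n) p<n)
    (trans (cong toℕ (Vecₚ.lookup∘tabulate _ (fromℕ< p<n)))
      (trans (Finₚ.toℕ-fromℕ< _) (cong g (Finₚ.toℕ-fromℕ< p<n))))

1⊕ʷ_ : ∀ {n} → Word n → Word (suc n)
1⊕ʷ σ = Fin.zero ∷ Vec.map Fin.suc σ

entry-map-suc : ∀ {k m} (σ : Vec (Fin k) m) {p} → p < m → entry (Vec.map Fin.suc σ) p ≡ suc (entry σ p)
entry-map-suc (_ ∷ _) {zero}  _         = refl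
entry-map-suc (_ ∷ σ) {suc p} (s≤s p<m) = entry-map-suc σ p<m

entry-1⊕ʷ : ∀ {n} (σ : Word n) {p} → p < suc n → entry (1⊕ʷ σ) p ≡ (1⊕ entry σ) p
entry-1⊕ʷ σ {zero}  _         = refl
entry-1⊕ʷ σ {suc p} (s≤s p<n) = entry-map-suc σ p<n

1⊕ʷ-injective : ∀ {n} {σ τ : Word n} → 1⊕ʷ σ ≡ 1⊕ʷ τ → σ ≡ τ
1⊕ʷ-injective {σ = σ} {τ} eq = entry-ext λ {p} p<n → suc-injective (begin
  suc (entry σ p)       ≡⟨ sym (entry-1⊕ʷ σ (s≤s p<n)) ⟩
  entry (1⊕ʷ σ) (suc p) ≡⟨ cong (λ w → entry w (suc p)) eq ⟩
  entry (1⊕ʷ τ) (suc p) ≡⟨ entry-1⊕ʷ τ (s≤s p<n) ⟩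
  suc (entry τ p)       ∎)
  where open ≡-Reasoning

first≡0⇒1⊕ʷ : ∀ {n} (w : Word (suc n)) → Restricted (entry w) (suc n) → entry w 0 ≡ 0 →
              ∃[ σ ] w ≡ 1⊕ʷ σ × Restricted (entry σ) n
first≡0⇒1⊕ʷ {n} (a ∷ w) R a≡0 = σ , a∷w≡1⊕ʷσ , Restricted-1⊕⁻ (Restricted-cong entry≡ R)
  where
  0≢ : ∀ i → Fin.zero ≢ lookup w i
  0≢ i 0≡wi = Restricted.injective R 0 (suc (toℕ i)) z<s (s≤s (Finₚ.toℕ<n i))
                (trans a≡0 (sym (trans (entry-lookup w i) (cong toℕ (sym 0≡wi)))))
  σ : Word n
  σ = Vec.tabulate (λ i → punchOut (0≢ i))
  a∷w≡1⊕ʷσ : a ∷ w ≡ 1⊕ʷ σ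
  a∷w≡1⊕ʷσ = cong₂ _∷_ (Finₚ.toℕ-injective a≡0) (begin
    w                                         ≡⟨ sym (Vecₚ.tabulate∘lookup w) ⟩
    Vec.tabulate (lookup w)                   ≡⟨ Vecₚ.tabulate-cong lookup≡ ⟩
    Vec.tabulate (lookup (Vec.map Fin.suc σ)) ≡⟨ Vecₚ.tabulate∘lookup _ ⟩
    Vec.map Fin.suc σ                         ∎)
    where
    open ≡-Reasoning
    lookup≡ : ∀ i → lookup w i ≡ lookup (Vec.map Fin.suc σ) i
    lookup≡ i = sym (trans (Vecₚ.lookup-map i Fin.suc σ)
                  (trans (cong Fin.suc (Vecₚ.lookup∘tabulate _ i)) (Finₚ.punchIn-punchOut (0≢ i))))
  entry≡ : ∀ {p} → p < suc n → entry (a ∷ w) p ≡ (1⊕ entry σ) p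
  entry≡ {p} p<n = trans (cong (λ w → entry w p) a∷w≡1⊕ʷσ) (entry-1⊕ʷ σ p<n)

swap01-bounded : ∀ m → Bounded swap01 (2 + m)
swap01-bounded m {zero}        _   = s≤s (s≤s z≤n)
swap01-bounded m {suc zero}    _   = z<s
swap01-bounded m {suc (suc _)} p<n = p<n

cycle-bounded : ∀ {m} (t : Fin m) → Bounded (cycle (2 + toℕ t)) (2 + m)
cycle-bounded t {zero}     _ = s≤s (s≤s (≤-trans (s≤s z≤n) (Finₚ.toℕ<n t)))
cycle-bounded t {suc zero} _ = z<s
cycle-bounded {m} t {p@(suc (suc _))} p<n with cycle-cases (2 + toℕ t) {p} (s≤s (s≤s z≤n))
... | inj₁ (p<q , c≡)      = subst (_< 2 + m) (sym c≡) (≤-<-trans p<q (s≤s (s≤s (Finₚ.toℕ<n t))))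
... | inj₂ (inj₁ (_ , c≡)) = subst (_< 2 + m) (sym c≡) (s≤s (s≤s z≤n))
... | inj₂ (inj₂ (_ , c≡)) = subst (_< 2 + m) (sym c≡) p<n

swapWord : ∀ m → Word (2 + m)
swapWord m = tabulateWord swap01 (swap01-bounded m)

cycleWord : ∀ {m} → Fin m → Word (2 + m)
cycleWord t = tabulateWord (cycle (2 + toℕ t)) (cycle-bounded t)

entry-swapWord : ∀ m {p} → p < 2 + m → entry (swapWord m) p ≡ swap01 p
entry-swapWord m = entry-tabulateWord swap01 (swap01-bounded m)

entry-cycleWord : ∀ {m} (t : Fin m) {p} → p < 2 + m → entry (cycleWord t) p ≡ cycle (2 + toℕ t) p
entry-cycleWord t = entry-tabulateWord (cycle (2 + toℕ t)) (cycle-bounded t)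

startingNonzero : (n : ℕ) → List (Word (suc n))
startingNonzero zero    = []
startingNonzero (suc m) = swapWord m ∷ map cycleWord (allFin m)

restrictedWords : (n : ℕ) → List (Word n)
restrictedWords zero    = [] ∷ []
restrictedWords (suc n) = map 1⊕ʷ_ (restrictedWords n) ++ startingNonzero n

length-startingNonzero : ∀ n → length (startingNonzero n) ≡ n
length-startingNonzero zero    = refl
length-startingNonzero (suc m) = cong suc (trans (length-map cycleWord (allFin m)) (length-tabulate _))

length-restrictedWords : ∀ n → length (restrictedWords n) ≡ n C 2 + 1
length-restrictedWords zero    = refl
length-restrictedWords (suc n) = begin
  length (map 1⊕ʷ_ (restrictedWords n) ++ startingNonzero n)
    ≡⟨ length-++ (map 1⊕ʷ_ (restrictedWords n)) ⟩
  length (map 1⊕ʷ_ (restrictedWords n)) + length (startingNonzero n)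
    ≡⟨ cong₂ _+_ (trans (length-map 1⊕ʷ_ (restrictedWords n)) (length-restrictedWords n)) (length-startingNonzero n) ⟩
  n C 2 + 1 + n     ≡⟨ +-comm (n C 2 + 1) n ⟩
  n + (n C 2 + 1)   ≡⟨ sym (+-assoc n (n C 2) 1) ⟩
  n + n C 2 + 1     ≡⟨ cong (λ k → k + n C 2 + 1) (sym (nC1≡n n)) ⟩
  n C 1 + n C 2 + 1 ≡⟨ cong (_+ 1) (nCk+nC[k+1]≡[n+1]C[k+1] n 1) ⟩
  suc n C 2 + 1     ∎
  where open ≡-Reasoning

swapWord≢cycleWord : ∀ {m} (t : Fin m) → swapWord m ≢ cycleWord t
swapWord≢cycleWord {m} t eq = contradiction
  (trans (sym (entry-swapWord m z<s)) (trans (cong (λ w → entry w 0) eq) (entry-cycleWord t z<s)))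
  λ ()

cycleWord-injective : ∀ {m} {t u : Fin m} → cycleWord t ≡ cycleWord u → t ≡ u
cycleWord-injective {m} {t} {u} eq = Finₚ.toℕ-injective (suc-injective (suc-injective (cycle≡1 (2 + toℕ t) (begin
  cycle (2 + toℕ u) (2 + toℕ t)   ≡⟨ sym (entry-cycleWord u qₜ<n) ⟩
  entry (cycleWord u) (2 + toℕ t) ≡⟨ cong (λ w → entry w (2 + toℕ t)) (sym eq) ⟩
  entry (cycleWord t) (2 + toℕ t) ≡⟨ entry-cycleWord t qₜ<n ⟩
  cycle (2 + toℕ t) (2 + toℕ t)   ≡⟨ cycle-at {2 + toℕ t} (s≤s (s≤s z≤n)) ⟩
  1                               ∎))))
  where
  open ≡-Reasoning
  qₜ<n : 2 + toℕ t < 2 + m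
  qₜ<n = s≤s (s≤s (Finₚ.toℕ<n t))

startingNonzero-first : ∀ n {w} → w ∈ startingNonzero n → 0 < entry w 0
startingNonzero-first (suc m) (here refl) = subst (0 <_) (sym (entry-swapWord m z<s)) z<s
startingNonzero-first (suc m) (there w∈) with ∈-map⁻ cycleWord w∈
... | t , _ , refl = subst (0 <_) (sym (entry-cycleWord t z<s)) z<s

startingNonzero-unique : ∀ n → Unique (startingNonzero n)
startingNonzero-unique zero    = []
startingNonzero-unique (suc m) =
  All.tabulate (λ w∈ eq → let t , _ , w≡ = ∈-map⁻ cycleWord w∈ in swapWord≢cycleWord t (trans eq w≡))
  ∷ Uniqueₚ.map⁺ cycleWord-injective (Uniqueₚ.allFin⁺ m)

restrictedWords-unique : ∀ n → Unique (restrictedWords n)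
restrictedWords-unique zero    = [] ∷ []
restrictedWords-unique (suc n) =
  Uniqueₚ.++⁺ (Uniqueₚ.map⁺ 1⊕ʷ-injective (restrictedWords-unique n)) (startingNonzero-unique n) disjoint
  where
  disjoint : Disjoint (map 1⊕ʷ_ (restrictedWords n)) (startingNonzero n)
  disjoint (w∈₁ , w∈₂) with ∈-map⁻ 1⊕ʷ_ w∈₁
  ... | _ , _ , refl = <-irrefl refl (startingNonzero-first n w∈₂)

startingNonzero-sound : ∀ n {w} → w ∈ startingNonzero n → Restricted (entry w) (suc n)
startingNonzero-sound (suc m) (here refl) =
  Restricted-cong (λ p<n → sym (entry-swapWord m p<n)) (swap01-restricted _)
startingNonzero-sound (suc m) (there w∈) with ∈-map⁻ cycleWord w∈
... | t , _ , refl = Restricted-cong (λ p<n → sym (entry-cycleWord t p<n)) (cycle-restricted (s≤s (s≤s z≤n)) _)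

restrictedWords-sound : ∀ n {w} → w ∈ restrictedWords n → Restricted (entry w) n
restrictedWords-sound zero    _  = restricted-empty
restrictedWords-sound (suc n) w∈ with ∈-++⁻ (map 1⊕ʷ_ (restrictedWords n)) w∈
... | inj₂ w∈′ = startingNonzero-sound n w∈′
... | inj₁ w∈′ with ∈-map⁻ 1⊕ʷ_ w∈′
...   | σ , σ∈ , refl = Restricted-cong (λ p<n → sym (entry-1⊕ʷ σ p<n)) (Restricted-1⊕⁺ (restrictedWords-sound n σ∈))

first≡1⇒∈startingNonzero : ∀ n (w : Word (suc n)) → Restricted (entry w) (suc n) → entry w 0 ≡ 1 →
                           w ∈ startingNonzero n
first≡1⇒∈startingNonzero zero    w _ x0≡1 = contradiction (subst (_< 1) x0≡1 (entry-bounded w z<s)) (<-irrefl refl)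
first≡1⇒∈startingNonzero (suc m) w R x0≡1 = here (entry-ext λ p<n →
  trans (first≡1⇒swap01 R (entry-bounded w) (entry-onto w (Restricted.injective R)) x0≡1 p<n)
        (sym (entry-swapWord m p<n)))

first≡2⇒∈startingNonzero : ∀ n (w : Word (suc n)) → Restricted (entry w) (suc n) → entry w 0 ≡ 2 →
                           w ∈ startingNonzero n
first≡2⇒∈startingNonzero zero       w _ x0≡2 = contradiction (subst (_< 1) x0≡2 (entry-bounded w z<s)) λ { (s≤s ()) }
first≡2⇒∈startingNonzero (suc zero) w _ x0≡2 = contradiction (subst (_< 2) x0≡2 (entry-bounded w z<s)) (<-irrefl refl)
first≡2⇒∈startingNonzero (suc (suc m)) w R x0≡2
  with first≡2⇒cycle R (entry-bounded w) (entry-onto w (Restricted.injective R)) x0≡2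
... | zero          , ()        , _ , _
... | suc zero      , s≤s ()    , _ , _
... | suc (suc d) , _ , s≤s (s≤s (s≤s d≤m)) , agree =
  there (subst (_∈ map cycleWord (allFin (suc m))) (sym w≡cycleWord) (∈-map⁺ cycleWord (∈-allFin t)))
  where
  t : Fin (suc m)
  t = fromℕ< (s≤s d≤m)
  w≡cycleWord : w ≡ cycleWord t
  w≡cycleWord = entry-ext λ {p} p<n →
    trans (agree p<n) (trans (cong (λ k → cycle (2 + k) p) (sym (Finₚ.toℕ-fromℕ< (s≤s d≤m))))
                             (sym (entry-cycleWord t p<n)))

restrictedWords-complete : ∀ n (w : Word n) → Restricted (entry w) n → w ∈ restrictedWords n
restrictedWords-complete zero    []  _ = here refl
restrictedWords-complete (suc n) w R
  with entry w 0 in x0≡ | FirstEntry.first≤2 R (entry-bounded w) (entry-onto w (Restricted.injective R))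
... | zero              | _ = let σ , w≡1⊕ʷσ , Rσ = first≡0⇒1⊕ʷ w R x0≡ in
  ∈-++⁺ˡ (subst (_∈ map 1⊕ʷ_ (restrictedWords n)) (sym w≡1⊕ʷσ) (∈-map⁺ 1⊕ʷ_ (restrictedWords-complete n σ Rσ)))
... | suc zero          | _ = ∈-++⁺ʳ (map 1⊕ʷ_ (restrictedWords n)) (first≡1⇒∈startingNonzero n w R x0≡)
... | suc (suc zero)    | _ = ∈-++⁺ʳ (map 1⊕ʷ_ (restrictedWords n)) (first≡2⇒∈startingNonzero n w R x0≡)
... | suc (suc (suc _)) | s≤s (s≤s ())

-- Counting

allWords-complete : ∀ k m (v : Vec (Fin k) m) → v ∈ allWords k m
allWords-complete k zero    []      = here refl
allWords-complete k (suc m) (x ∷ v) =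
  ∈-concat⁺′ (∈-map⁺ (x ∷_) (allWords-complete k m v)) (∈-map⁺ _ (∈-tabulate⁺ x))

allWords-unique : ∀ k m → Unique (allWords k m)
allWords-unique k zero    = [] ∷ []
allWords-unique k (suc m) =
  Uniqueₚ.concat⁺ (Allₚ.map⁺ (Allₚ.tabulate⁺ λ _ → Uniqueₚ.map⁺ Vecₚ.∷-injectiveʳ (allWords-unique k m)))
                  (AllPairsₚ.map⁺ (AllPairsₚ.tabulate⁺ disjoint))
  where
  disjoint : ∀ {i j : Fin k} → i ≢ j → Disjoint (map (i ∷_) (allWords k m)) (map (j ∷_) (allWords k m))
  disjoint i≢j (v∈i , v∈j) with ∈-map⁻ _ v∈i | ∈-map⁻ _ v∈j
  ... | _ , _ , refl | _ , _ , eq = i≢j (Vecₚ.∷-injectiveˡ eq)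

unique-∼set⇒length≡ : ∀ {A : Set} {xs ys : List A} → Unique xs → Unique ys →
                      (∀ {a} → a ∈ xs ⇔ a ∈ ys) → length xs ≡ length ys
unique-∼set⇒length≡ xs! ys! xs∼ys = ↭-length (∼bag⇒↭ (unique∧set⇒bag xs! ys! xs∼ys))

theorem3p7 : (n : ℕ) → countF n ≡ (n C 2) + 1
theorem3p7 n = begin
  countF n                   ≡⟨ unique-∼set⇒length≡ counted-unique (restrictedWords-unique n) counted⇔restricted ⟩
  length (restrictedWords n) ≡⟨ length-restrictedWords n ⟩
  n C 2 + 1                  ∎
  where
  open ≡-Reasoning
  counted-unique : Unique (filter (T? ∘ isRestricted) (perms n))
  counted-unique = Uniqueₚ.filter⁺ (T? ∘ isRestricted) (Uniqueₚ.filter⁺ (T? ∘ isPerm) (allWords-unique n n))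
  counted⇔restricted : ∀ {w} → w ∈ filter (T? ∘ isRestricted) (perms n) ⇔ w ∈ restrictedWords n
  counted⇔restricted {w} = mk⇔
    (λ w∈ →
       let w∈perms , restricted = ∈-filter⁻ (T? ∘ isRestricted) {xs = perms n} w∈
           _ , perm             = ∈-filter⁻ (T? ∘ isPerm) {xs = allWords n n} w∈perms
       in restrictedWords-complete n w (to (T-restricted w) (perm , restricted)))
    (λ w∈ →
       let perm , restricted = from (T-restricted w) (restrictedWords-sound n w∈)
       in ∈-filter⁺ (T? ∘ isRestricted) (∈-filter⁺ (T? ∘ isPerm) (allWords-complete n n w) perm) restricted)
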